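{- The number of valid Septoku boards (maps $s:\{1,\dots,37\}\to\{1,\dots,7\}$ satisfying the Septoku rules, with no identification by symmetries or symbol permutations) is exactly $120{,}960 = 24\cdot 7!$.
   Context: The Septoku board consists of 37 cells forming a regular hexagon of side 4 in a hexagonal grid, numbered row by row: $1$–$4$ (top row), $5$–$9$, $10$–$15$, $16$–$22$, $23$–$28$, $29$–$33$, $34$–$37$ (bottom row). The 21 "rows" of the board are: horizontal $\{1,2,3,4\}$, $\{5,\dots,9\}$, $\{10,\dots,15\}$, $\{16,\dots,22\}$, $\{23,\dots,28\}$, $\{29,\dots,33\}$, $\{34,\dots,37\}$; up-right $\{1,5,10,16\}$, $\{2,6,11,17,23\}$, $\{3,7,12,18,24,29\}$, $\{4,8,13,19,25,30,34\}$, $\{9,14,20,26,31,35\}$, $\{15,21,27,32,36\}$, $\{22,28,33,37\}$; down-right $\{4,9,15,22\}$, $\{3,8,14,21,28\}$, $\{2,7,13,20,27,33\}$, $\{1,6,12,19,26,32,37\}$, $\{5,11,18,25,31,36\}$, $\{10,17,24,30,35\}$, $\{16,23,29,34\}$. The seven "circles" are: $\{1,2,5,6,7,11,12\}$, $\{3,4,7,8,9,13,14\}$, $\{10,11,16,17,18,23,24\}$, $\{12,13,18,19,20,25,26\}$, $\{14,15,20,21,22,27,28\}$, $\{24,25,29,30,31,34,35\}$, $\{26,27,31,32,33,36,37\}$. A valid Septoku board is a map $s:\{1,\dots,37\}\to\{1,\dots,7\}$ such that the cells of each of the 21 rows receive pairwise distinct values and the seven cells of each circle receive pairwise distinct values.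 -}

module Defs where

open import Data.Nat using (ℕ; suc; _<_)
open import Data.Fin using (Fin; fromℕ<)
open import Data.Vec using (Vec; lookup)
open import Data.List using (List; _∷_; []; map)
open import Data.List.Relation.Unary.All using (All)
open import Data.List.Relation.Unary.Unique.Propositional using (Unique)
open import Relation.Nullary.Decidable using (True; toWitness)
open import Data.Nat.Properties using (_<?_)
open import Data.Product using (_×_)

-- Symbols 1..7 are represented by Fin 7 (symbol i ↦ i-1); the encoding is
-- a bijection, so it does not affect counting.
Symbol : Set
Symbol = Fin 7

-- Cell k (1 ≤ k ≤ 37, paper numbering) is represented by Fin 37 element k-1.
Cell : Set
Cell = Fin 37

cell : (k : ℕ) → {True (k Data.Nat.∸ 1 <? 37)} → Cell
cell k {p} = fromℕ< (toWitness p)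

-- A board s : {1..37} → {1..7} is a vector of length 37 (entry k-1 = s(k)).
Board : Set
Board = Vec Symbol 37

-- The 21 rows of the board (horizontal, up-right, down-right).
rows : List (List Cell)
rows =
    (cell 1 ∷ cell 2 ∷ cell 3 ∷ cell 4 ∷ [])
  ∷ (cell 5 ∷ cell 6 ∷ cell 7 ∷ cell 8 ∷ cell 9 ∷ [])
  ∷ (cell 10 ∷ cell 11 ∷ cell 12 ∷ cell 13 ∷ cell 14 ∷ cell 15 ∷ [])
  ∷ (cell 16 ∷ cell 17 ∷ cell 18 ∷ cell 19 ∷ cell 20 ∷ cell 21 ∷ cell 22 ∷ [])
  ∷ (cell 23 ∷ cell 24 ∷ cell 25 ∷ cell 26 ∷ cell 27 ∷ cell 28 ∷ [])
  ∷ (cell 29 ∷ cell 30 ∷ cell 31 ∷ cell 32 ∷ cell 33 ∷ [])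
  ∷ (cell 34 ∷ cell 35 ∷ cell 36 ∷ cell 37 ∷ [])
  ∷ (cell 1 ∷ cell 5 ∷ cell 10 ∷ cell 16 ∷ [])
  ∷ (cell 2 ∷ cell 6 ∷ cell 11 ∷ cell 17 ∷ cell 23 ∷ [])
  ∷ (cell 3 ∷ cell 7 ∷ cell 12 ∷ cell 18 ∷ cell 24 ∷ cell 29 ∷ [])
  ∷ (cell 4 ∷ cell 8 ∷ cell 13 ∷ cell 19 ∷ cell 25 ∷ cell 30 ∷ cell 34 ∷ [])
  ∷ (cell 9 ∷ cell 14 ∷ cell 20 ∷ cell 26 ∷ cell 31 ∷ cell 35 ∷ [])
  ∷ (cell 15 ∷ cell 21 ∷ cell 27 ∷ cell 32 ∷ cell 36 ∷ [])
  ∷ (cell 22 ∷ cell 28 ∷ cell 33 ∷ cell 37 ∷ [])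
  ∷ (cell 4 ∷ cell 9 ∷ cell 15 ∷ cell 22 ∷ [])
  ∷ (cell 3 ∷ cell 8 ∷ cell 14 ∷ cell 21 ∷ cell 28 ∷ [])
  ∷ (cell 2 ∷ cell 7 ∷ cell 13 ∷ cell 20 ∷ cell 27 ∷ cell 33 ∷ [])
  ∷ (cell 1 ∷ cell 6 ∷ cell 12 ∷ cell 19 ∷ cell 26 ∷ cell 32 ∷ cell 37 ∷ [])
  ∷ (cell 5 ∷ cell 11 ∷ cell 18 ∷ cell 25 ∷ cell 31 ∷ cell 36 ∷ [])
  ∷ (cell 10 ∷ cell 17 ∷ cell 24 ∷ cell 30 ∷ cell 35 ∷ [])
  ∷ (cell 16 ∷ cell 23 ∷ cell 29 ∷ cell 34 ∷ [])
  ∷ []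

circles : List (List Cell)
circles =
    (cell 1 ∷ cell 2 ∷ cell 5 ∷ cell 6 ∷ cell 7 ∷ cell 11 ∷ cell 12 ∷ [])
  ∷ (cell 3 ∷ cell 4 ∷ cell 7 ∷ cell 8 ∷ cell 9 ∷ cell 13 ∷ cell 14 ∷ [])
  ∷ (cell 10 ∷ cell 11 ∷ cell 16 ∷ cell 17 ∷ cell 18 ∷ cell 23 ∷ cell 24 ∷ [])
  ∷ (cell 12 ∷ cell 13 ∷ cell 18 ∷ cell 19 ∷ cell 20 ∷ cell 25 ∷ cell 26 ∷ [])
  ∷ (cell 14 ∷ cell 15 ∷ cell 20 ∷ cell 21 ∷ cell 22 ∷ cell 27 ∷ cell 28 ∷ [])
  ∷ (cell 24 ∷ cell 25 ∷ cell 29 ∷ cell 30 ∷ cell 31 ∷ cell 34 ∷ cell 35 ∷ [])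
  ∷ (cell 26 ∷ cell 27 ∷ cell 31 ∷ cell 32 ∷ cell 33 ∷ cell 36 ∷ cell 37 ∷ [])
  ∷ []

Distinct : Board → List Cell → Set
Distinct s g = Unique (map (lookup s) g)

Valid : Board → Set
Valid s = All (Distinct s) rows × All (Distinct s) circles

-- A valid board is a proper 7-colouring of the graph on the 37 cells in
-- which two cells are adjacent when they share a row or a circle.  The seven
-- cells of the first circle are pairwise adjacent, so every valid board is,
-- in exactly one way, a permutation of the symbols applied to a valid board
-- that gives those cells the symbols 0, …, 6.  A backtracking search, which
-- colours the cells one at a time and checks each against its already
-- coloured neighbours, finds the 7! = 5040 permutations and exactly 24 such
-- normalised boards.

module Submission where

open import Defs
open import Data.List using (List; length)
open import Data.List.Relation.Unary.All using (All)
open import Data.List.Relation.Unary.Unique.Propositional using (Unique)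
open import Data.List.Membership.Propositional using (_∈_)
open import Data.Product using (Σ; _×_)
open import Relation.Binary.PropositionalEquality using (_≡_)

open import Data.Nat using (ℕ; zero; suc; _+_; _*_)
import Data.Nat.Properties as ℕ
open import Data.Fin using (Fin; zero; suc; _≟_; punchOut)
open import Data.Fin.Properties using (all?; any?; injective⇒≤; punchOut-injective)
open import Data.List using ([]; _∷_; map; filter; concatMap; allFin)
import Data.List as List
open import Data.List.Properties using (length-++; length-map)
import Data.List.Relation.Unary.All as All
open Data.List.Relation.Unary.All using ([]; _∷_)
import Data.List.Relation.Unary.All.Properties as All
import Data.List.Relation.Unary.AllPairs as AllPairs
import Data.List.Relation.Unary.AllPairs.Properties as AllPairs
open import Data.List.Relation.Unary.AllPairs using ([]; _∷_)
open import Data.List.Relation.Unary.Any using (here; there)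
import Data.List.Relation.Unary.Unique.Propositional.Properties as Unique
open import Data.List.Membership.Propositional using (find; lose)
open import Data.List.Membership.Propositional.Properties
  using ( ∈-map⁺; ∈-map⁻; ∈-filter⁺; ∈-filter⁻; ∈-allFin
        ; ∈-concatMap⁺; ∈-concatMap⁻; ∈-++⁺ˡ; ∈-++⁺ʳ )
import Data.List.Membership.DecPropositional as DecMembership
open import Data.Vec using (Vec; []; _∷_; _++_; lookup; tabulate; splitAt)
import Data.Vec as Vec
import Data.Vec.Properties as Vec
open import Data.Product using (_,_; proj₁; proj₂; ∃)
import Data.Product as Product
import Data.Product.Properties as Product
open import Data.Sum using (_⊎_; inj₁; inj₂)
open import Function using (_∘_; _⇔_; mk⇔; Equivalence)
open import Function.Definitions using (Injective)
open import Relation.Nullary using (Dec; yes; no; ¬?; contradiction)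
open import Relation.Nullary.Decidable using (toWitness; _→-dec_; _⊎-dec_)
open import Relation.Binary.PropositionalEquality
  using (_≢_; _≗_; refl; sym; trans; cong; cong₂; subst; module ≡-Reasoning)

module _ {A B : Set} (f : A → List B) where

  ∈-concatMap⁺′ : ∀ {xs x y} → x ∈ xs → y ∈ f x → y ∈ concatMap f xs
  ∈-concatMap⁺′ x∈xs y∈fx = ∈-concatMap⁺ f (lose x∈xs y∈fx)

  ∈-concatMap⁻′ : ∀ xs {y} → y ∈ concatMap f xs → ∃ λ x → x ∈ xs × y ∈ f x
  ∈-concatMap⁻′ xs y∈ = find (∈-concatMap⁻ f y∈)

  unique-concatMap : ∀ {xs} → Unique xs → (∀ {x} → x ∈ xs → Unique (f x)) →
                     (∀ {x x′ y} → y ∈ f x → y ∈ f x′ → x ≡ x′) →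
                     Unique (concatMap f xs)
  unique-concatMap unique-xs unique-f disjoint = Unique.concat⁺
    (All.map⁺ (All.tabulate unique-f))
    (AllPairs.map⁺ (AllPairs.map (λ x≢x′ {_} (y∈fx , y∈fx′) → x≢x′ (disjoint y∈fx y∈fx′))
                                 unique-xs))

  length-concatMap : ∀ {c} xs → (∀ x → length (f x) ≡ c) →
                     length (concatMap f xs) ≡ length xs * c
  length-concatMap []       _      = refl
  length-concatMap (x ∷ xs) length-f =
    trans (length-++ (f x)) (cong₂ _+_ (length-f x) (length-concatMap xs length-f))

vec-map-injective : ∀ {A B : Set} {f : A → B} {n} → Injective _≡_ _≡_ f →
                    Injective _≡_ _≡_ (Vec.map {n = n} f)
vec-map-injective _           {[]}     {[]}     _  = refl
vec-map-injective f-injective {x ∷ xs} {y ∷ ys} eq =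
  cong₂ _∷_ (f-injective (Vec.∷-injectiveˡ eq))
            (vec-map-injective f-injective (Vec.∷-injectiveʳ eq))

reindex : ∀ {A : Set} {m n} → (Fin m → Fin n) → Vec A n → Vec A m
reindex σ t = tabulate (lookup t ∘ σ)

reindex-inverse : ∀ {A : Set} {m n} {σ : Fin m → Fin n} {τ : Fin n → Fin m} →
                  (∀ i → τ (σ i) ≡ i) → (t : Vec A m) → reindex σ (reindex τ t) ≡ t
reindex-inverse {σ = σ} {τ} τ∘σ t = begin
  tabulate (lookup (tabulate (lookup t ∘ τ)) ∘ σ) ≡⟨ Vec.tabulate-cong lookup-σ ⟩
  tabulate (lookup t)                             ≡⟨ Vec.tabulate∘lookup t ⟩
  t                                               ∎
  where
  open ≡-Reasoning
  lookup-σ : ∀ i → lookup (tabulate (lookup t ∘ τ)) (σ i) ≡ lookup t i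
  lookup-σ i = trans (Vec.lookup∘tabulate _ (σ i)) (cong (lookup t) (τ∘σ i))

-- Proper colourings of graphs given by edge lists

Proper : {I A : Set} → (I → A) → List (I × I) → Set
Proper f E = All (λ e → f (proj₁ e) ≢ f (proj₂ e)) E

module _ {I A : Set} where

  proper-cong : ∀ {f g : I → A} {E} → f ≗ g → Proper f E → Proper g E
  proper-cong f≗g = All.map λ {e} fe≢ ge≡ →
    fe≢ (trans (f≗g (proj₁ e)) (trans ge≡ (sym (f≗g (proj₂ e)))))

  proper-relabel : ∀ {B : Set} {π : A → B} {f : I → A} {E} →
                   Injective _≡_ _≡_ π → Proper f E → Proper (π ∘ f) E
  proper-relabel π-injective = All.map (_∘ π-injective)

  proper-map : ∀ {J : Set} {f : I → A} {g : J → I} {E} →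
               Proper (f ∘ g) E ⇔ Proper f (map (Product.map g g) E)
  proper-map = mk⇔ All.map⁺ All.map⁻

pairs : {A : Set} → List A → List (A × A)
pairs []       = []
pairs (x ∷ xs) = map (x ,_) xs List.++ pairs xs

module _ {I A : Set} {f : I → A} where

  unique-map⇔proper-pairs : ∀ xs → Unique (map f xs) ⇔ Proper f (pairs xs)
  unique-map⇔proper-pairs xs = mk⇔ (to xs) (from xs)
    where
    to : ∀ xs → Unique (map f xs) → Proper f (pairs xs)
    to []       []                = []
    to (x ∷ xs) (fx∉fxs ∷ unique) =
      All.++⁺ (All.map⁺ (All.map⁻ fx∉fxs)) (to xs unique)

    from : ∀ xs → Proper f (pairs xs) → Unique (map f xs)
    from []       []     = []
    from (x ∷ xs) proper =
      let proper-x , proper-xs = All.++⁻ (map (x ,_) xs) proper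
      in All.map⁺ (All.map⁻ proper-x) ∷ from xs proper-xs

  all-unique⇔proper-concatMap-pairs : ∀ gs →
    All (λ g → Unique (map f g)) gs ⇔ Proper f (concatMap pairs gs)
  all-unique⇔proper-concatMap-pairs gs = mk⇔
    (All.concat⁺ ∘ All.map⁺ ∘ All.map (Equivalence.to (unique-map⇔proper-pairs _)))
    (All.map (Equivalence.from (unique-map⇔proper-pairs _)) ∘ All.map⁻ ∘ All.concat⁻)

pairs-complete : ∀ {A : Set} {xs : List A} {i j} →
                 i ∈ xs → j ∈ xs → i ≢ j → (i , j) ∈ pairs xs ⊎ (j , i) ∈ pairs xs
pairs-complete (here refl)  (here refl)  i≢j = contradiction refl i≢j
pairs-complete (here refl)  (there j∈xs) _   = inj₁ (∈-++⁺ˡ (∈-map⁺ _ j∈xs))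
pairs-complete (there i∈xs) (here refl)  _   = inj₂ (∈-++⁺ˡ (∈-map⁺ _ i∈xs))
pairs-complete {xs = x ∷ xs} (there i∈xs) (there j∈xs) i≢j
  with pairs-complete i∈xs j∈xs i≢j
... | inj₁ ij∈ = inj₁ (∈-++⁺ʳ (map (x ,_) xs) ij∈)
... | inj₂ ji∈ = inj₂ (∈-++⁺ʳ (map (x ,_) xs) ji∈)

Edges : ℕ → Set
Edges n = List (Fin n × Fin n)

Complete : ∀ {n} → Edges n → Set
Complete E = ∀ i j → i ≢ j → (i , j) ∈ E ⊎ (j , i) ∈ E

complete? : ∀ {n} (E : Edges n) → Dec (Complete E)
complete? E =
  all? λ i → all? λ j → ¬? (i ≟ j) →-dec ((i , j) ∈? E ⊎-dec (j , i) ∈? E)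
  where open DecMembership (Product.≡-dec _≟_ _≟_)

completeGraph : ∀ n → Edges n
completeGraph n = pairs (allFin n)

completeGraph-complete : ∀ n → Complete (completeGraph n)
completeGraph-complete n i j = pairs-complete (∈-allFin i) (∈-allFin j)

module _ {n} {A : Set} {f : Fin n → A} where

  proper-complete⇒injective : ∀ {E} → Complete E → Proper f E → Injective _≡_ _≡_ f
  proper-complete⇒injective complete proper {i} {j} fi≡fj with i ≟ j
  ... | yes i≡j = i≡j
  ... | no  i≢j with complete i j i≢j
  ...   | inj₁ ij∈E = contradiction fi≡fj (All.lookup proper ij∈E)
  ...   | inj₂ ji∈E = contradiction (sym fi≡fj) (All.lookup proper ji∈E)

  injective⇒proper-completeGraph : Injective _≡_ _≡_ f → Proper f (completeGraph n)
  injective⇒proper-completeGraph f-injective =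
    Equivalence.to (unique-map⇔proper-pairs (allFin n))
      (Unique.map⁺ f-injective (Unique.allFin⁺ n))

-- Injective endomaps of Fin n are invertible

injective⇒surjective : ∀ {n} {f : Fin n → Fin n} → Injective _≡_ _≡_ f →
                       ∀ y → ∃ λ x → f x ≡ y
injective⇒surjective {suc n} {f} f-injective y with any? (λ x → f x ≟ y)
... | yes preimage = preimage
... | no  ∄x       = contradiction (injective⇒≤ g-injective) ℕ.1+n≰n
  where
  y≢f : ∀ x → y ≢ f x
  y≢f x y≡fx = ∄x (x , sym y≡fx)

  g : Fin (suc n) → Fin n
  g x = punchOut (y≢f x)

  g-injective : Injective _≡_ _≡_ g
  g-injective {x} {x′} = f-injective ∘ punchOut-injective (y≢f x) (y≢f x′)

module _ {n} {f : Fin n → Fin n} (f-injective : Injective _≡_ _≡_ f) where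

  inverse : Fin n → Fin n
  inverse y = proj₁ (injective⇒surjective f-injective y)

  inverseʳ : ∀ y → f (inverse y) ≡ y
  inverseʳ y = proj₂ (injective⇒surjective f-injective y)

  inverseˡ : ∀ x → inverse (f x) ≡ x
  inverseˡ x = f-injective (inverseʳ (f x))

  inverse-injective : Injective _≡_ _≡_ inverse
  inverse-injective {y} {y′} eq = trans (sym (inverseʳ y)) (trans (cong f eq) (inverseʳ y′))

injective? : ∀ {m n} (f : Fin m → Fin n) → Dec (∀ i j → f i ≡ f j → i ≡ j)
injective? f = all? λ i → all? λ j → f i ≟ f j →-dec i ≟ j

-- Backtracking search

-- Vertex 0 is coloured last: a colouring of Fin (suc n) is the colour of 0
-- in front of a colouring of the other vertices, renumbered by pred.

incidentZero : ∀ {n} → Edges (suc n) → Edges (suc n)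
incidentZero []                    = []
incidentZero ((zero  , j) ∷ E)     = (zero , j) ∷ incidentZero E
incidentZero ((suc i , zero) ∷ E)  = (suc i , zero) ∷ incidentZero E
incidentZero ((suc i , suc j) ∷ E) = incidentZero E

dropZero : ∀ {n} → Edges (suc n) → Edges n
dropZero []                    = []
dropZero ((zero  , j) ∷ E)     = dropZero E
dropZero ((suc i , zero) ∷ E)  = dropZero E
dropZero ((suc i , suc j) ∷ E) = (i , j) ∷ dropZero E

dropZeros : ∀ n {m} → Edges (n + m) → Edges m
dropZeros zero    E = E
dropZeros (suc n) E = dropZeros n (dropZero E)

module _ {A : Set} {n} {x : A} {xs : Vec A n} where

  proper-∷⁺ : ∀ {E} → Proper (lookup (x ∷ xs)) (incidentZero E) →
              Proper (lookup xs) (dropZero E) → Proper (lookup (x ∷ xs)) E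
  proper-∷⁺ {[]}                   _            _            = []
  proper-∷⁺ {(zero  , j) ∷ E}      (p ∷ ps)     qs           = p ∷ proper-∷⁺ ps qs
  proper-∷⁺ {(suc i , zero) ∷ E}   (p ∷ ps)     qs           = p ∷ proper-∷⁺ ps qs
  proper-∷⁺ {(suc i , suc j) ∷ E}  ps           (q ∷ qs)     = q ∷ proper-∷⁺ ps qs

  proper-∷⁻ : ∀ {E} → Proper (lookup (x ∷ xs)) E →
              Proper (lookup (x ∷ xs)) (incidentZero E) × Proper (lookup xs) (dropZero E)
  proper-∷⁻ {[]}                  []       = [] , []
  proper-∷⁻ {(zero  , j) ∷ E}     (p ∷ ps) = Product.map₁ (p ∷_) (proper-∷⁻ ps)
  proper-∷⁻ {(suc i , zero) ∷ E}  (p ∷ ps) = Product.map₁ (p ∷_) (proper-∷⁻ ps)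
  proper-∷⁻ {(suc i , suc j) ∷ E} (p ∷ ps) = Product.map₂ (p ∷_) (proper-∷⁻ ps)

proper-++⁻ : ∀ {A : Set} {n m} (xs : Vec A n) {ys : Vec A m} {E} →
             Proper (lookup (xs ++ ys)) E → Proper (lookup ys) (dropZeros n E)
proper-++⁻ []         proper = proper
proper-++⁻ (x ∷ xs)   proper = proper-++⁻ xs (proj₂ (proper-∷⁻ proper))

module Search {k : ℕ} where

  Colouring : ℕ → Set
  Colouring = Vec (Fin k)

  proper? : ∀ {n} (E : Edges n) (t : Colouring n) → Dec (Proper (lookup t) E)
  proper? E t = All.all? (λ e → ¬? (lookup t (proj₁ e) ≟ lookup t (proj₂ e))) E

  extensions : ∀ {n} → Edges (suc n) → Colouring n → List (Colouring (suc n))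
  extensions E t = filter (proper? E) (map (_∷ t) (allFin k))

  ∈-extensions⁺ : ∀ {n E x} {t : Colouring n} →
                  Proper (lookup (x ∷ t)) E → x ∷ t ∈ extensions E t
  ∈-extensions⁺ {x = x} proper = ∈-filter⁺ (proper? _) (∈-map⁺ _ (∈-allFin x)) proper

  ∈-extensions⁻ : ∀ {n E s} {t : Colouring n} → s ∈ extensions E t →
                  ∃ λ x → s ≡ x ∷ t × Proper (lookup s) E
  ∈-extensions⁻ {E = E} {t = t} s∈
    with ∈-filter⁻ (proper? E) {xs = map (_∷ t) (allFin k)} s∈
  ... | s∈map , proper with ∈-map⁻ (_∷ t) s∈map
  ...   | x , _ , s≡x∷t = x , s≡x∷t , proper

  extensions-unique : ∀ {n} E (t : Colouring n) → Unique (extensions E t)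
  extensions-unique E t =
    Unique.filter⁺ (proper? E) (Unique.map⁺ Vec.∷-injectiveˡ (Unique.allFin⁺ k))

  colouringsFrom : ∀ {m} → Colouring m → ∀ n → Edges (n + m) → List (Colouring (n + m))
  colouringsFrom base zero    E = filter (proper? E) (base ∷ [])
  colouringsFrom base (suc n) E =
    concatMap (extensions (incidentZero E)) (colouringsFrom base n (dropZero E))

  module _ {m} {base : Colouring m} where

    ∈-colouringsFrom⁺ : ∀ {n E} (u : Colouring n) →
                        Proper (lookup (u ++ base)) E → u ++ base ∈ colouringsFrom base n E
    ∈-colouringsFrom⁺ []       proper = ∈-filter⁺ (proper? _) (here refl) proper
    ∈-colouringsFrom⁺ (x ∷ u) proper =
      let proper-x , proper-u = proper-∷⁻ proper
      in ∈-concatMap⁺′ (extensions _) (∈-colouringsFrom⁺ u proper-u)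
                                      (∈-extensions⁺ proper-x)

    ∈-colouringsFrom⁻ : ∀ {n E t} → t ∈ colouringsFrom base n E →
                        ∃ λ (u : Colouring n) → t ≡ u ++ base × Proper (lookup t) E
    ∈-colouringsFrom⁻ {zero} {E} t∈ with ∈-filter⁻ (proper? E) {xs = base ∷ []} t∈
    ... | here refl , proper = [] , refl , proper
    ∈-colouringsFrom⁻ {suc n} {E} t∈
      with ∈-concatMap⁻′ (extensions _) (colouringsFrom base n (dropZero E)) t∈
    ... | s , s∈ , t∈ext with ∈-extensions⁻ t∈ext | ∈-colouringsFrom⁻ s∈
    ...   | x , refl , proper-x | u , refl , proper-s =
      x ∷ u , refl , proper-∷⁺ proper-x proper-s

    colouringsFrom-unique : ∀ n E → Unique (colouringsFrom base n E)
    colouringsFrom-unique zero    E = Unique.filter⁺ (proper? E) {xs = base ∷ []} ([] ∷ [])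
    colouringsFrom-unique (suc n) E =
      unique-concatMap (extensions _) (colouringsFrom-unique n (dropZero E))
        (λ _ → extensions-unique _ _) same-tail
      where
      same-tail : ∀ {t t′ s} → s ∈ extensions (incidentZero E) t →
                  s ∈ extensions (incidentZero E) t′ → t ≡ t′
      same-tail s∈ s∈′ with ∈-extensions⁻ s∈ | ∈-extensions⁻ s∈′
      ... | _ , refl , _ | _ , refl , _ = refl

  ∈-colouringsFrom-[]⁺ : ∀ {n E} (t : Colouring (n + 0)) → Proper (lookup t) E →
                         t ∈ colouringsFrom [] n E
  ∈-colouringsFrom-[]⁺ {n} t proper with splitAt n t
  ... | u , [] , refl = ∈-colouringsFrom⁺ u proper

-- Symmetry reduction

-- If the last k vertices form a clique, every proper k-colouring is the
-- image, under a unique permutation of the colours, of a unique proper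
-- colouring that colours those vertices 0, 1, …, k - 1.
module SymmetryReduction {k n : ℕ} (E : Edges (n + k))
  (clique : Complete (dropZeros n E))
  (permutations : List (Vec (Fin k) k))
  (permutations-unique : Unique permutations)
  (∈-permutations⁺ : ∀ {p} → Injective _≡_ _≡_ (lookup p) → p ∈ permutations)
  (∈-permutations⁻ : ∀ {p} → p ∈ permutations → Injective _≡_ _≡_ (lookup p))
  where

  open Search {k}

  normalForms : List (Colouring (n + k))
  normalForms = colouringsFrom (Vec.allFin k) n E

  relabel : ∀ {m} → Vec (Fin k) k → Colouring m → Colouring m
  relabel p = Vec.map (lookup p)

  relabellings : Vec (Fin k) k → List (Colouring (n + k))
  relabellings p = map (relabel p) normalForms

  colourings : List (Colouring (n + k))
  colourings = concatMap relabellings permutations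

  relabel-normalForm : ∀ p {t} → t ∈ normalForms →
                       ∃ λ (u : Colouring n) → relabel p t ≡ u ++ p
  relabel-normalForm p t∈ with ∈-colouringsFrom⁻ {base = Vec.allFin k} {n} {E} t∈
  ... | u , refl , _ = relabel p u , (begin
    relabel p (u ++ Vec.allFin k)            ≡⟨ Vec.map-++ (lookup p) u _ ⟩
    relabel p u ++ relabel p (Vec.allFin k)  ≡⟨ cong (relabel p u ++_) (Vec.map-lookup-allFin p) ⟩
    relabel p u ++ p                         ∎)
    where open ≡-Reasoning

  ∈-colourings⁻ : ∀ {t} → t ∈ colourings → Proper (lookup t) E
  ∈-colourings⁻ t∈ with ∈-concatMap⁻′ relabellings permutations t∈
  ... | p , p∈ , t∈relabellings with ∈-map⁻ _ t∈relabellings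
  ...   | s , s∈ , refl =
    proper-cong (λ i → sym (Vec.lookup-map i (lookup p) s))
      (proper-relabel (∈-permutations⁻ p∈)
        (proj₂ (proj₂ (∈-colouringsFrom⁻ {base = Vec.allFin k} {n} {E} s∈))))

  ∈-colourings⁺ : ∀ t → Proper (lookup t) E → t ∈ colourings
  ∈-colourings⁺ t proper-t with splitAt n t
  ... | u , p , refl =
    ∈-concatMap⁺′ relabellings (∈-permutations⁺ {p} p-injective)
      (subst (_∈ relabellings p) relabel-normalise (∈-map⁺ _ normalise-∈))
    where
    open ≡-Reasoning

    p-injective : Injective _≡_ _≡_ (lookup p)
    p-injective = proper-complete⇒injective clique (proper-++⁻ u proper-t)

    p⁻¹ : Fin k → Fin k
    p⁻¹ = inverse p-injective

    normalise : Vec.map p⁻¹ (u ++ p) ≡ Vec.map p⁻¹ u ++ Vec.allFin k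
    normalise = begin
      Vec.map p⁻¹ (u ++ p)            ≡⟨ Vec.map-++ p⁻¹ u p ⟩
      Vec.map p⁻¹ u ++ Vec.map p⁻¹ p  ≡⟨ cong (Vec.map p⁻¹ u ++_) p⁻¹∘p ⟩
      Vec.map p⁻¹ u ++ Vec.allFin k   ∎
      where
      p⁻¹∘p : Vec.map p⁻¹ p ≡ Vec.allFin k
      p⁻¹∘p = begin
        Vec.map p⁻¹ p                      ≡⟨ cong (Vec.map p⁻¹) (Vec.tabulate∘lookup p) ⟨
        Vec.map p⁻¹ (tabulate (lookup p))  ≡⟨ Vec.tabulate-∘ p⁻¹ (lookup p) ⟨
        tabulate (p⁻¹ ∘ lookup p)          ≡⟨ Vec.tabulate-cong (inverseˡ p-injective) ⟩
        Vec.allFin k                       ∎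

    normalise-∈ : Vec.map p⁻¹ (u ++ p) ∈ normalForms
    normalise-∈ = subst (_∈ normalForms) (sym normalise)
      (∈-colouringsFrom⁺ (Vec.map p⁻¹ u) (subst (λ s → Proper (lookup s) E) normalise
        (proper-cong (λ i → sym (Vec.lookup-map i p⁻¹ (u ++ p)))
          (proper-relabel (inverse-injective p-injective) proper-t))))

    relabel-normalise : relabel p (Vec.map p⁻¹ (u ++ p)) ≡ u ++ p
    relabel-normalise = begin
      relabel p (Vec.map p⁻¹ (u ++ p))    ≡⟨ Vec.map-∘ (lookup p) p⁻¹ _ ⟨
      Vec.map (lookup p ∘ p⁻¹) (u ++ p)   ≡⟨ Vec.map-cong (inverseʳ p-injective) _ ⟩
      Vec.map Function.id (u ++ p)        ≡⟨ Vec.map-id _ ⟩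
      u ++ p                              ∎

  colourings-unique : Unique colourings
  colourings-unique = unique-concatMap relabellings permutations-unique
    (λ p∈ → Unique.map⁺ (vec-map-injective (∈-permutations⁻ p∈))
                        (colouringsFrom-unique n E))
    same-permutation
    where
    same-permutation : ∀ {p p′ t} → t ∈ relabellings p → t ∈ relabellings p′ →
                       p ≡ p′
    same-permutation {p} {p′} t∈ t∈′ with ∈-map⁻ _ t∈ | ∈-map⁻ _ t∈′
    ... | s , s∈ , refl | s′ , s′∈ , eq
      with relabel-normalForm p s∈ | relabel-normalForm p′ s′∈
    ...   | u , p-suffix | u′ , p′-suffix =
      Vec.++-injectiveʳ u u′ (trans (sym p-suffix) (trans eq p′-suffix))

  length-colourings : length colourings ≡ length permutations * length normalForms
  length-colourings = length-concatMap relabellings permutations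
    (λ p → length-map (relabel p) normalForms)

-- Septoku

edges : List (Cell × Cell)
edges = concatMap pairs (rows List.++ circles)

valid⇔proper : ∀ s → Valid s ⇔ Proper (lookup s) edges
valid⇔proper s = mk⇔
  (λ (valid-rows , valid-circles) → to (All.++⁺ valid-rows valid-circles))
  (All.++⁻ rows ∘ from)
  where open Equivalence (all-unique⇔proper-concatMap-pairs {f = lookup s} (rows List.++ circles))

-- The search colours the cells from the back of this list to the front,
-- starting with the first circle.
searchOrder : Vec Cell 37
searchOrder =
  cell 37 ∷ cell 36 ∷ cell 35 ∷ cell 34 ∷ cell 33 ∷ cell 32 ∷ cell 30 ∷
  cell 29 ∷ cell 22 ∷ cell 21 ∷ cell 17 ∷ cell 16 ∷ cell 28 ∷ cell 23 ∷
  cell 31 ∷ cell 27 ∷ cell 24 ∷ cell 26 ∷ cell 25 ∷ cell 19 ∷ cell 20 ∷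
  cell 15 ∷ cell 9 ∷ cell 8 ∷ cell 4 ∷ cell 14 ∷ cell 10 ∷ cell 18 ∷
  cell 13 ∷ cell 3 ∷ cell 12 ∷ cell 11 ∷ cell 7 ∷ cell 6 ∷ cell 5 ∷
  cell 2 ∷ cell 1 ∷ []

searchOrder-injective : Injective _≡_ _≡_ (lookup searchOrder)
searchOrder-injective {i} {j} = toWitness {a? = injective? (lookup searchOrder)} _ i j

position : Cell → Fin 37
position = inverse searchOrder-injective

toSearch : Board → Vec Symbol 37
toSearch = reindex (lookup searchOrder)

fromSearch : Vec Symbol 37 → Board
fromSearch = reindex position

toSearch-fromSearch : ∀ t → toSearch (fromSearch t) ≡ t
toSearch-fromSearch =
  reindex-inverse {σ = lookup searchOrder} {τ = position} (inverseˡ searchOrder-injective)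

fromSearch-toSearch : ∀ s → fromSearch (toSearch s) ≡ s
fromSearch-toSearch =
  reindex-inverse {σ = position} {τ = lookup searchOrder} (inverseʳ searchOrder-injective)

fromSearch-injective : Injective _≡_ _≡_ fromSearch
fromSearch-injective {t} {t′} eq = begin
  t                         ≡⟨ toSearch-fromSearch t ⟨
  toSearch (fromSearch t)   ≡⟨ cong toSearch eq ⟩
  toSearch (fromSearch t′)  ≡⟨ toSearch-fromSearch t′ ⟩
  t′                        ∎
  where open ≡-Reasoning

-- Opaque so that the search is only ever run in the clique check and in
-- the two length computations, never while unifying.
opaque
  searchEdges : Edges 37
  searchEdges = map (Product.map position position) edges

opaque
  unfolding searchEdges

  fromSearch-valid : ∀ {t} → Proper (lookup t) searchEdges → Valid (fromSearch t)
  fromSearch-valid {t} proper = Equivalence.from (valid⇔proper (fromSearch t))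
    (proper-cong (λ c → sym (Vec.lookup∘tabulate (lookup t ∘ position) c))
      (Equivalence.from (proper-map {f = lookup t} {g = position} {E = edges}) proper))

  toSearch-proper : ∀ {s} → Valid s → Proper (lookup (toSearch s)) searchEdges
  toSearch-proper {s} valid =
    Equivalence.to (proper-map {f = lookup (toSearch s)} {g = position} {E = edges})
      (proper-cong lookup-position (Equivalence.to (valid⇔proper s) valid))
    where
    lookup-position : ∀ c → lookup s c ≡ lookup (toSearch s) (position c)
    lookup-position c = sym (trans
      (Vec.lookup∘tabulate (lookup s ∘ lookup searchOrder) (position c))
      (cong (lookup s) (inverseʳ searchOrder-injective c)))

  firstCircle-clique : Complete (dropZeros 30 searchEdges)
  firstCircle-clique = toWitness {a? = complete? (dropZeros 30 searchEdges)} _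

opaque
  permutations : List (Vec Symbol 7)
  permutations = Search.colouringsFrom [] 7 (completeGraph 7)

opaque
  unfolding permutations

  permutations-unique : Unique permutations
  permutations-unique = Search.colouringsFrom-unique 7 (completeGraph 7)

  ∈-permutations⁻ : ∀ {p} → p ∈ permutations → Injective _≡_ _≡_ (lookup p)
  ∈-permutations⁻ p∈ = proper-complete⇒injective (completeGraph-complete 7)
    (proj₂ (proj₂ (Search.∈-colouringsFrom⁻ {base = []} {7} {completeGraph 7} p∈)))

  ∈-permutations⁺ : ∀ {p} → Injective _≡_ _≡_ (lookup p) → p ∈ permutations
  ∈-permutations⁺ {p} p-injective =
    Search.∈-colouringsFrom-[]⁺ {n = 7} {E = completeGraph 7} p
      (injective⇒proper-completeGraph p-injective)

  permutations-length : length permutations ≡ 5040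
  permutations-length = refl

open SymmetryReduction {7} {30} searchEdges firstCircle-clique
  permutations permutations-unique ∈-permutations⁺ ∈-permutations⁻

opaque
  unfolding searchEdges

  normalForms-length : length normalForms ≡ 24
  normalForms-length = refl

boards : List Board
boards = map fromSearch colourings

boards-unique : Unique boards
boards-unique = Unique.map⁺ fromSearch-injective colourings-unique

boards-valid : All Valid boards
boards-valid = All.map⁺ (All.tabulate λ {t} t∈ → fromSearch-valid {t} (∈-colourings⁻ t∈))

boards-complete : ∀ s → Valid s → s ∈ boards
boards-complete s valid =
  subst (_∈ boards) (fromSearch-toSearch s)
    (∈-map⁺ fromSearch (∈-colourings⁺ (toSearch s) (toSearch-proper {s} valid)))

boards-length : length boards ≡ 120960
boards-length = begin
  length boards                             ≡⟨ length-map fromSearch colourings ⟩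
  length colourings                         ≡⟨ length-colourings ⟩
  length permutations * length normalForms  ≡⟨ cong₂ _*_ permutations-length normalForms-length ⟩
  5040 * 24                                 ∎
  where open ≡-Reasoning

theorem5 : Σ (List Board) (λ L → Unique L × All Valid L × ((s : Board) → Valid s → s ∈ L) × length L ≡ 120960)
theorem5 = boards , boards-unique , boards-valid , boards-complete , boards-length
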